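{- Let $t\ge 1$ be an integer and $d = 2^t+1$. Then the number of linear bipermutive local rules $f:\mathbb{F}_2^d\to\mathbb{F}_2$ (i.e. rules $f(x_1,\ldots,x_d)=a_1x_1\oplus\cdots\oplus a_dx_d$ with $a_i\in\mathbb{F}_2$ and $a_1=a_d=1$) for which the no-boundary cellular automaton $F:\mathbb{F}_2^{2(d-1)}\to\mathbb{F}_2^{d-1}$ with local rule $f$ is self-orthogonal is $2^{d-3}$.
   Context: For a local rule $f:\mathbb{F}_2^d\to\mathbb{F}_2$, the no-boundary cellular automaton (NBCA) $F:\mathbb{F}_2^{2(d-1)}\to\mathbb{F}_2^{d-1}$ is defined by $F(x_1,\ldots,x_{2(d-1)}) = (f(x_1,\ldots,x_d), f(x_2,\ldots,x_{d+1}),\ldots, f(x_{d-1},\ldots,x_{2(d-1)}))$. The rule $f$ is bipermutive if it is a permutation in the first variable when the others are fixed, and in the last variable when the others are fixed. Let $N = 2^{d-1}$, fix a bijection $\phi:\mathbb{F}_2^{d-1}\to\{1,\ldots,N\}$ with inverse $\psi$. The Cayley table of $F$ is the $N\times N$ matrix $C_F$ with $C_F(i,j) = \phi(F(\psi(i)\|\psi(j)))$ ($\|$ is concatenation); for bipermutive $f$ it is a Latin square. Two Latin squares $L_1,L_2$ of order $N$ are orthogonal if the pairs $(L_1(i,j),L_2(i,j))$ are pairwise distinct over all $(i,j)$. $F$ is self-orthogonal if $C_F$ is orthogonal to its transpose $C_F^\top$. -}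

module Defs where

open import Data.Bool using (Bool; true; false; _∧_; _xor_)
open import Data.Nat using (ℕ; suc; _+_; _^_)
open import Data.Nat.Properties using (+-mono-<-≤)
open import Data.Fin using (Fin; toℕ; fromℕ<)
open import Data.Fin.Properties using (toℕ<n; toℕ≤pred[n])
open import Data.Vec using (Vec; lookup; tabulate; zipWith; foldr; _++_)
open import Data.Product using (_×_)
open import Function.Bundles using (_↔_; Inverse)
open import Relation.Binary.PropositionalEquality using (_≡_)

-- Local rules on d = suc n variables are maps  Vec Bool (suc n) → Bool
-- (Bool models F₂, _xor_ is addition, _∧_ is multiplication).

linearRule : ∀ {d} → Vec Bool d → Vec Bool d → Bool
linearRule a x = foldr (λ _ → Bool) _xor_ false (zipWith _∧_ a x)

shift : ∀ {n} → Fin n → Fin (suc n) → Fin (n + n)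
shift {n} i k = fromℕ< (+-mono-<-≤ (toℕ<n i) (toℕ≤pred[n] k))

-- No-boundary CA  F : F₂^{2(d-1)} → F₂^{d-1}  with d = suc n:
-- F(x)_i = f(x_i, …, x_{i+d-1})  (0-indexed),  i = 0, …, n-1.
NBCA : ∀ {n} → (Vec Bool (suc n) → Bool) → Vec Bool (n + n) → Vec Bool n
NBCA {n} f x = tabulate (λ i → f (tabulate (λ k → lookup x (shift i k))))

Square : ℕ → Set
Square N = Fin N → Fin N → Fin N

transpose : ∀ {N} → Square N → Square N
transpose L i j = L j i

Orthogonal : ∀ {N} → Square N → Square N → Set
Orthogonal L₁ L₂ = ∀ i j k l → L₁ i j ≡ L₁ k l → L₂ i j ≡ L₂ k l → (i ≡ k × j ≡ l)

-- Cayley table of F : F₂^{2n} → F₂^n w.r.t. a bijection φ : F₂^n → {1..2^n}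
-- (Inverse.to φ is φ, Inverse.from φ is ψ).
Cayley : ∀ {n} → (Vec Bool n ↔ Fin (2 ^ n)) → (Vec Bool (n + n) → Vec Bool n) → Square (2 ^ n)
Cayley φ F i j = Inverse.to φ (F (Inverse.from φ i ++ Inverse.from φ j))

SelfOrthogonal : ∀ {n} → (Vec Bool n ↔ Fin (2 ^ n)) → (Vec Bool (n + n) → Vec Bool n) → Set
SelfOrthogonal φ F = Orthogonal (Cayley φ F) (transpose (Cayley φ F))

{-# OPTIONS --safe #-}
module Submission where

-- A linear rule a acts on sequences s : ℕ → F₂ as the operator A = Σₖ aₖ Sᵏ, S the left shift.
-- Repeating x‖y with period 2n (n = 2^t), the two Cayley cells F(x‖y) and F(y‖x) are together
-- the first 2n values of A applied to that sequence, so F is self-orthogonal iff A is injective on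
-- 2n-periodic sequences. In characteristic 2 squaring doubles the stride, A^(2^r) = Σₖ aₖ S^(2^r k),
-- so on 2n-periodic sequences A^(2n) is multiplication by the weight Σₖ aₖ: for odd weight A is
-- injective, for even weight A kills constants, i.e. F(1‖1) = F(0‖0). Counting odd-weight a with
-- a₁ = a_d = 1 gives 2^(d-3).

open import Defs
open import Algebra.Bundles using (CommutativeRing)
open import Data.Bool using (Bool; true; false; not; _∧_; _xor_)
open import Data.Bool.Properties
  using (xor-assoc; xor-comm; xor-same; xor-identityʳ; not-involutive;
         ∧-zeroʳ; ∧-distribˡ-xor; ∧-distribʳ-xor; ¬-not; xor-∧-commutativeRing)
open import Data.Fin using (Fin; toℕ; fromℕ<; zero; suc; _↑ˡ_; _↑ʳ_; splitAt; join)
open import Data.Fin.Properties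
  using (toℕ<n; toℕ-fromℕ<; fromℕ<-toℕ; fromℕ<-cong; toℕ-↑ˡ; toℕ-↑ʳ; join-splitAt)
open import Data.List using (List; []; _∷_; length; map)
import Data.List as List
open import Data.List.Properties using (length-map; length-++)
open import Data.List.Membership.Propositional using (_∈_)
open import Data.List.Membership.Propositional.Properties
  using (∈-map⁺; ∈-map⁻; ∈-++⁺ˡ; ∈-++⁺ʳ; ∈-++⁻)
open import Data.List.Relation.Unary.Any using (here)
open import Data.List.Relation.Unary.AllPairs using ([]; _∷_)
open import Data.List.Relation.Unary.All using ([])
open import Data.List.Relation.Unary.Unique.Propositional using (Unique)
open import Data.List.Relation.Unary.Unique.Propositional.Properties using (++⁺; map⁺)
open import Data.Nat using (ℕ; zero; suc; _+_; _*_; _≤_; _^_; _∸_; NonZero; s≤s; >-nonZero⁻¹)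
open import Data.Nat.DivMod
  using (_%_; _/_; _mod_; m≡m%n+[m/n]*n; m%n<n; m<n⇒m%n≡m; [m+n]%n≡m%n; %-congˡ)
open import Data.Nat.Properties
  using (+-assoc; +-comm; +-suc; +-identityʳ; m^n≢0; ^-monoʳ-≤; +-commutativeSemigroup)
open import Data.Product using (Σ; _×_; _,_; uncurry)
open import Data.Product.Function.NonDependent.Propositional using (_×-⇔_)
open import Data.Product.Properties using (,-injectiveˡ; ,-injectiveʳ)
open import Data.Sum using (inj₁; inj₂)
open import Data.Vec using (Vec; []; _∷_; _++_; _∷ʳ_; head; last; lookup; tabulate; replicate; initLast)
open import Data.Vec.Properties
  using (lookup∘tabulate; lookup-replicate; lookup-++ˡ; lookup-++ʳ; last-∷ʳ;
         ∷-injectiveʳ; ∷ʳ-injectiveˡ)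
open import Data.Vec.Relation.Binary.Pointwise.Extensional using (ext; Pointwise-≡⇒≡)
open import Function.Bundles using (_↔_; _⇔_; mk⇔; Inverse; Injection)
open import Function.Construct.Composition using (_⇔-∘_)
open import Function.Construct.Identity using (⇔-id)
open import Function.Construct.Symmetry using (⇔-sym; ↔-sym)
open import Function.Definitions using (Injective)
open import Function.Properties.Inverse using (Inverse⇒Injection)
open import Relation.Binary.PropositionalEquality
open import Relation.Nullary using (¬_)
open ≡-Reasoning

open import Algebra.Properties.CommutativeSemigroup +-commutativeSemigroup
  using () renaming (x∙yz≈y∙xz to +-left-comm)
open import Algebra.Properties.CommutativeSemigroup
  (CommutativeRing.+-commutativeSemigroup xor-∧-commutativeRing)
  using () renaming (interchange to xor-interchange)

private variable d : ℕ

2^r+2^r≡2^[1+r] : ∀ r → 2 ^ r + 2 ^ r ≡ 2 ^ suc r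
2^r+2^r≡2^[1+r] r = cong (2 ^ r +_) (sym (+-identityʳ (2 ^ r)))

parity : ∀ {m} → Vec Bool m → Bool
parity []      = false
parity (c ∷ v) = c xor parity v

Periodic : ℕ → (ℕ → Bool) → Set
Periodic p s = ∀ j → s (p + j) ≡ s j

periodic-*+ : ∀ {p} {s : ℕ → Bool} → Periodic p s → ∀ q j → s (q * p + j) ≡ s j
periodic-*+ per zero    j = refl
periodic-*+ {p} {s} per (suc q) j =
  trans (cong s (+-assoc p (q * p) j)) (trans (per (q * p + j)) (periodic-*+ per q j))

periodic-% : ∀ {p} .{{_ : NonZero p}} {s : ℕ → Bool} → Periodic p s → ∀ j → s j ≡ s (j % p)
periodic-% {p} {s} per j = begin
  s j                   ≡⟨ cong s (m≡m%n+[m/n]*n j p) ⟩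
  s (j % p + j / p * p) ≡⟨ cong s (+-comm (j % p) (j / p * p)) ⟩
  s (j / p * p + j % p) ≡⟨ periodic-*+ per (j / p) (j % p) ⟩
  s (j % p)             ∎

-- convolve m a is the operator Σₖ aₖ S^(mk).
convolve : ℕ → Vec Bool d → (ℕ → Bool) → ℕ → Bool
convolve m []      s i = false
convolve m (c ∷ a) s i = (c ∧ s i) xor convolve m a s (m + i)

module _ (m : ℕ) where

  convolve-cong : (a : Vec Bool d) {s r : ℕ → Bool} → s ≗ r → convolve m a s ≗ convolve m a r
  convolve-cong []      s≗r i = refl
  convolve-cong (c ∷ a) s≗r i = cong₂ (λ u v → (c ∧ u) xor v) (s≗r i) (convolve-cong a s≗r (m + i))

  convolve-shift : (a : Vec Bool d) (s : ℕ → Bool) (k i : ℕ) →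
                   convolve m a (λ j → s (k + j)) i ≡ convolve m a s (k + i)
  convolve-shift []      s k i = refl
  convolve-shift (c ∷ a) s k i = cong ((c ∧ s (k + i)) xor_) (begin
    convolve m a (λ j → s (k + j)) (m + i) ≡⟨ convolve-shift a s k (m + i) ⟩
    convolve m a s (k + (m + i))           ≡⟨ cong (convolve m a s) (+-left-comm k m i) ⟩
    convolve m a s (m + (k + i))           ∎)

  convolve-xor : (a : Vec Bool d) (s r : ℕ → Bool) (i : ℕ) →
                 convolve m a (λ j → s j xor r j) i ≡ convolve m a s i xor convolve m a r i
  convolve-xor []      s r i = refl
  convolve-xor (c ∷ a) s r i = begin
    (c ∧ (s i xor r i)) xor convolve m a (λ j → s j xor r j) (m + i)
      ≡⟨ cong₂ _xor_ (∧-distribˡ-xor c (s i) (r i)) (convolve-xor a s r (m + i)) ⟩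
    ((c ∧ s i) xor (c ∧ r i)) xor (convolve m a s (m + i) xor convolve m a r (m + i))
      ≡⟨ xor-interchange (c ∧ s i) (c ∧ r i) _ _ ⟩
    ((c ∧ s i) xor convolve m a s (m + i)) xor ((c ∧ r i) xor convolve m a r (m + i))
      ∎

  convolve-false : (a : Vec Bool d) (i : ℕ) → convolve m a (λ _ → false) i ≡ false
  convolve-false []      i = refl
  convolve-false (c ∷ a) i = cong₂ _xor_ (∧-zeroʳ c) (convolve-false a (m + i))

  convolve-∧ : (a : Vec Bool d) (c : Bool) (s : ℕ → Bool) (i : ℕ) →
               convolve m a (λ j → c ∧ s j) i ≡ c ∧ convolve m a s i
  convolve-∧ a true  s i = refl
  convolve-∧ a false s i = convolve-false a i

  periodic-convolve : ∀ {p} (a : Vec Bool d) {s : ℕ → Bool} → Periodic p s → Periodic p (convolve m a s)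
  periodic-convolve {p = p} a {s} per j = trans (sym (convolve-shift a s p j)) (convolve-cong a per j)

  convolve-period : (a : Vec Bool d) {s : ℕ → Bool} → Periodic m s →
                    ∀ i → convolve m a s i ≡ parity a ∧ s i
  convolve-period []      per i = refl
  convolve-period (c ∷ a) {s} per i = begin
    (c ∧ s i) xor convolve m a s (m + i)
      ≡⟨ cong ((c ∧ s i) xor_) (trans (convolve-period a per (m + i)) (cong (parity a ∧_) (per i))) ⟩
    (c ∧ s i) xor (parity a ∧ s i)
      ≡⟨ ∧-distribʳ-xor (s i) c (parity a) ⟨
    (c xor parity a) ∧ s i
      ∎

  -- Frobenius: writing A = c + Sᵐ B, the cross terms of A² cancel in characteristic 2.
  convolve-square : (a : Vec Bool d) (s : ℕ → Bool) (i : ℕ) →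
                    convolve m a (convolve m a s) i ≡ convolve (m + m) a s i
  convolve-square []      s i = refl
  convolve-square (c ∷ a) s i = begin
    A₀ xor B (λ j → (c ∧ s j) xor B s (m + j)) (m + i)
      ≡⟨ cong (A₀ xor_) (convolve-xor a (λ j → c ∧ s j) (λ j → B s (m + j)) (m + i)) ⟩
    A₀ xor (B (λ j → c ∧ s j) (m + i) xor B (λ j → B s (m + j)) (m + i))
      ≡⟨ cong (λ u → A₀ xor (u xor B (λ j → B s (m + j)) (m + i))) (convolve-∧ a c s (m + i)) ⟩
    A₀ xor ((c ∧ B s (m + i)) xor B (λ j → B s (m + j)) (m + i))
      ≡⟨ cross-terms-cancel c (s i) (B s (m + i)) _ ⟩
    (c ∧ s i) xor B (λ j → B s (m + j)) (m + i)
      ≡⟨ cong ((c ∧ s i) xor_) tail-square ⟩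
    (c ∧ s i) xor convolve (m + m) a s (m + m + i)
      ∎
    where
    B : (ℕ → Bool) → ℕ → Bool
    B = convolve m a

    A₀ : Bool
    A₀ = c ∧ ((c ∧ s i) xor B s (m + i))

    cross-terms-cancel : ∀ c x y z → (c ∧ ((c ∧ x) xor y)) xor ((c ∧ y) xor z) ≡ (c ∧ x) xor z
    cross-terms-cancel false x y z = refl
    cross-terms-cancel true  x y z = begin
      (x xor y) xor (y xor z) ≡⟨ xor-assoc x y (y xor z) ⟩
      x xor (y xor (y xor z)) ≡⟨ cong (x xor_) (xor-assoc y y z) ⟨
      x xor ((y xor y) xor z) ≡⟨ cong (λ u → x xor (u xor z)) (xor-same y) ⟩
      x xor z                 ∎

    tail-square : B (λ j → B s (m + j)) (m + i) ≡ convolve (m + m) a s (m + m + i)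
    tail-square = begin
      B (λ j → B s (m + j)) (m + i)      ≡⟨ convolve-shift a (B s) m (m + i) ⟩
      B (B s) (m + (m + i))              ≡⟨ convolve-square a s (m + (m + i)) ⟩
      convolve (m + m) a s (m + (m + i)) ≡⟨ cong (convolve (m + m) a s) (+-assoc m m i) ⟨
      convolve (m + m) a s (m + m + i)   ∎

  convolve-double-cong : (a : Vec Bool d) {g h : ℕ → Bool} →
                         convolve m a g ≗ convolve m a h → convolve (m + m) a g ≗ convolve (m + m) a h
  convolve-double-cong a {g} {h} eq i =
    trans (sym (convolve-square a g i)) (trans (convolve-cong a eq i) (convolve-square a h i))

convolve-2^-cong : (a : Vec Bool d) {g h : ℕ → Bool} → convolve 1 a g ≗ convolve 1 a h →
                   ∀ r → convolve (2 ^ r) a g ≗ convolve (2 ^ r) a h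
convolve-2^-cong a eq zero = eq
convolve-2^-cong a {g} {h} eq (suc r) =
  subst (λ m → convolve m a g ≗ convolve m a h) (2^r+2^r≡2^[1+r] r)
        (convolve-double-cong (2 ^ r) a (convolve-2^-cong a eq r))

odd⇒convolve-injective : ∀ {r} (a : Vec Bool d) {g h : ℕ → Bool} → parity a ≡ true →
                         Periodic (2 ^ r) g → Periodic (2 ^ r) h →
                         convolve 1 a g ≗ convolve 1 a h → g ≗ h
odd⇒convolve-injective {r = r} a {g} {h} odd pg ph eq j = begin
  g j                    ≡⟨ weight pg ⟨
  convolve (2 ^ r) a g j ≡⟨ convolve-2^-cong a eq r j ⟩
  convolve (2 ^ r) a h j ≡⟨ weight ph ⟩
  h j                    ∎
  where
  weight : ∀ {s} → Periodic (2 ^ r) s → convolve (2 ^ r) a s j ≡ s j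
  weight {s} per = trans (convolve-period (2 ^ r) a per j) (cong (_∧ s j) odd)

record Window {m} (s : ℕ → Bool) (o : ℕ) (w : Vec Bool m) : Set where
  constructor window
  field
    lookup-window : ∀ f → lookup w f ≡ s (o + toℕ f)

open Window

replicate-window : ∀ {m o} (b : Bool) → Window (λ _ → b) o (replicate m b)
replicate-window b = window λ f → lookup-replicate f b

window-unique : ∀ {m o} {s r : ℕ → Bool} {u v : Vec Bool m} →
                s ≗ r → Window s o u → Window r o v → u ≡ v
window-unique s≗r (window hu) (window hv) =
  Pointwise-≡⇒≡ (ext λ f → trans (hu f) (trans (s≗r _) (sym (hv f))))

module _ {s : ℕ → Bool} {o : ℕ} where

  window-tail : ∀ {m} {b : Bool} {w : Vec Bool m} → Window s o (b ∷ w) → Window s (suc o) w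
  window-tail (window hw) = window λ f → trans (hw (suc f)) (cong s (+-suc o (toℕ f)))

  window-periodic : ∀ {p m} {w : Vec Bool m} → Periodic p s → Window s o w → Window s (o + p) w
  window-periodic {p} {w = w} per (window hw) = window λ f → begin
    lookup w f          ≡⟨ hw f ⟩
    s (o + toℕ f)       ≡⟨ per (o + toℕ f) ⟨
    s (p + (o + toℕ f)) ≡⟨ cong s (+-left-comm p o (toℕ f)) ⟩
    s (o + (p + toℕ f)) ≡⟨ cong s (+-assoc o p (toℕ f)) ⟨
    s (o + p + toℕ f)   ∎

  module _ {m k : ℕ} (x : Vec Bool m) (y : Vec Bool k) where

    private
      offset-↑ʳ : (i : Fin k) → o + toℕ (m ↑ʳ i) ≡ o + m + toℕ i
      offset-↑ʳ i = trans (cong (o +_) (toℕ-↑ʳ m i)) (sym (+-assoc o m (toℕ i)))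

    window-++ˡ : Window s o (x ++ y) → Window s o x
    window-++ˡ (window h) = window λ i → begin
      lookup x i               ≡⟨ lookup-++ˡ x y i ⟨
      lookup (x ++ y) (i ↑ˡ k) ≡⟨ h (i ↑ˡ k) ⟩
      s (o + toℕ (i ↑ˡ k))     ≡⟨ cong (λ j → s (o + j)) (toℕ-↑ˡ i k) ⟩
      s (o + toℕ i)            ∎

    window-++ʳ : Window s o (x ++ y) → Window s (o + m) y
    window-++ʳ (window h) = window λ i → begin
      lookup y i               ≡⟨ lookup-++ʳ x y i ⟨
      lookup (x ++ y) (m ↑ʳ i) ≡⟨ h (m ↑ʳ i) ⟩
      s (o + toℕ (m ↑ʳ i))     ≡⟨ cong s (offset-↑ʳ i) ⟩
      s (o + m + toℕ i)        ∎

    window-++ : Window s o x → Window s (o + m) y → Window s o (x ++ y)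
    window-++ (window hx) (window hy) = window λ f →
      subst (λ f → lookup (x ++ y) f ≡ s (o + toℕ f)) (join-splitAt m k f) (at-join (splitAt m f))
      where
      at-join : ∀ e → lookup (x ++ y) (join m k e) ≡ s (o + toℕ (join m k e))
      at-join (inj₁ i) = begin
        lookup (x ++ y) (i ↑ˡ k) ≡⟨ lookup-++ˡ x y i ⟩
        lookup x i               ≡⟨ hx i ⟩
        s (o + toℕ i)            ≡⟨ cong (λ j → s (o + j)) (toℕ-↑ˡ i k) ⟨
        s (o + toℕ (i ↑ˡ k))     ∎
      at-join (inj₂ i) = begin
        lookup (x ++ y) (m ↑ʳ i) ≡⟨ lookup-++ʳ x y i ⟩
        lookup y i               ≡⟨ hy i ⟩
        s (o + m + toℕ i)        ≡⟨ cong s (offset-↑ʳ i) ⟨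
        s (o + toℕ (m ↑ʳ i))     ∎

periodic-window-unique : ∀ {p} .{{_ : NonZero p}} {s r : ℕ → Bool} {w : Vec Bool p} →
                         Periodic p s → Periodic p r → Window s 0 w → Window r 0 w → s ≗ r
periodic-window-unique {p} {s} {r} {w} ps pr (window ws) (window wr) j = begin
  s j                ≡⟨ periodic-% ps j ⟩
  s (j % p)          ≡⟨ cong s (toℕ-fromℕ< (m%n<n j p)) ⟨
  s (toℕ (j mod p))  ≡⟨ ws (j mod p) ⟨
  lookup w (j mod p) ≡⟨ wr (j mod p) ⟩
  r (toℕ (j mod p))  ≡⟨ cong r (toℕ-fromℕ< (m%n<n j p)) ⟩
  r (j % p)          ≡⟨ periodic-% pr j ⟨
  r j                ∎

cycle : ∀ {p} .{{_ : NonZero p}} → Vec Bool p → ℕ → Bool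
cycle {p} w j = lookup w (j mod p)

module _ {p} .{{_ : NonZero p}} (w : Vec Bool p) where

  cycle-periodic : Periodic p (cycle w)
  cycle-periodic j =
    cong (lookup w) (fromℕ<-cong _ _ (trans (%-congˡ (+-comm p j)) ([m+n]%n≡m%n j p)) _ _)

  cycle-window : Window (cycle w) 0 w
  cycle-window = window λ f → cong (lookup w) (sym (begin
    toℕ f mod p      ≡⟨ fromℕ<-cong _ _ (m<n⇒m%n≡m (toℕ<n f)) _ (toℕ<n f) ⟩
    fromℕ< (toℕ<n f) ≡⟨ fromℕ<-toℕ f _ ⟩
    f                ∎))

linearRule-window : (a w : Vec Bool d) {s : ℕ → Bool} {o : ℕ} →
                    Window s o w → linearRule a w ≡ convolve 1 a s o
linearRule-window []      []      _ = refl
linearRule-window (c ∷ a) (b ∷ w) {s} {o} hw@(window h) =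
  cong₂ (λ u v → (c ∧ u) xor v) (trans (h zero) (cong s (+-identityʳ o)))
                                (linearRule-window a w (window-tail hw))

window-NBCA : ∀ {n} (a : Vec Bool (suc n)) {z : Vec Bool (n + n)} {s : ℕ → Bool} {o : ℕ} →
              Window s o z → Window (convolve 1 a s) o (NBCA (linearRule a) z)
window-NBCA {n} a {z} {s} {o} (window hz) = window λ i → begin
  lookup (NBCA (linearRule a) z) i         ≡⟨ lookup∘tabulate _ i ⟩
  linearRule a (tabulate (neighbourhood i)) ≡⟨ linearRule-window a _ (neighbourhood-window i) ⟩
  convolve 1 a s (o + toℕ i)               ∎
  where
  neighbourhood : Fin n → Fin (suc n) → Bool
  neighbourhood i k = lookup z (shift i k)

  neighbourhood-window : ∀ i → Window s (o + toℕ i) (tabulate (neighbourhood i))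
  neighbourhood-window i = window λ k → begin
    lookup (tabulate (neighbourhood i)) k ≡⟨ lookup∘tabulate (neighbourhood i) k ⟩
    lookup z (shift i k)                  ≡⟨ hz (shift i k) ⟩
    s (o + toℕ (shift i k))               ≡⟨ cong (λ j → s (o + j)) (toℕ-fromℕ< _) ⟩
    s (o + (toℕ i + toℕ k))               ≡⟨ cong s (+-assoc o (toℕ i) (toℕ k)) ⟨
    s (o + toℕ i + toℕ k)                 ∎

swapPair : ∀ {n} → (Vec Bool (n + n) → Vec Bool n) → Vec Bool n × Vec Bool n → Vec Bool n × Vec Bool n
swapPair F (x , y) = F (x ++ y) , F (y ++ x)

selfOrthogonal⇔swapPair-injective : ∀ {n} (φ : Vec Bool n ↔ Fin (2 ^ n))
                                    (F : Vec Bool (n + n) → Vec Bool n) →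
                                    SelfOrthogonal φ F ⇔ Injective _≡_ _≡_ (swapPair F)
selfOrthogonal⇔swapPair-injective φ F = mk⇔ ⇒-injective ⇐-injective
  where
  open Inverse φ using (to; from; strictlyInverseʳ)

  to-injective : Injective _≡_ _≡_ to
  to-injective = Injection.injective (Inverse⇒Injection φ)

  from-injective : Injective _≡_ _≡_ from
  from-injective = Injection.injective (Inverse⇒Injection (↔-sym φ))

  cell : ∀ x y → Cayley φ F (to x) (to y) ≡ to (F (x ++ y))
  cell x y = cong₂ (λ u v → to (F (u ++ v))) (strictlyInverseʳ x) (strictlyInverseʳ y)

  ⇒-injective : SelfOrthogonal φ F → Injective _≡_ _≡_ (swapPair F)
  ⇒-injective so {x , y} {x′ , y′} eq
    with to-x≡ , to-y≡ ← so (to x) (to y) (to x′) (to y′)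
           (trans (cell x y) (trans (cong to (,-injectiveˡ eq)) (sym (cell x′ y′))))
           (trans (cell y x) (trans (cong to (,-injectiveʳ eq)) (sym (cell y′ x′))))
    = cong₂ _,_ (to-injective to-x≡) (to-injective to-y≡)

  ⇐-injective : Injective _≡_ _≡_ (swapPair F) → SelfOrthogonal φ F
  ⇐-injective inj i j k l e₁ e₂ = from-injective (,-injectiveˡ eq) , from-injective (,-injectiveʳ eq)
    where
    eq : (from i , from j) ≡ (from k , from l)
    eq = inj (cong₂ _,_ (to-injective e₁) (to-injective e₂))

swapPair-window : ∀ {n} .{{_ : NonZero (n + n)}} (a : Vec Bool (suc n)) (x y : Vec Bool n) →
                  Window (convolve 1 a (cycle (x ++ y))) 0
                         (uncurry _++_ (swapPair (NBCA (linearRule a)) (x , y)))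
swapPair-window {n} a x y = window-++ _ _ (window-NBCA a xy-window) (window-NBCA a yx-window)
  where
  xy-window : Window (cycle (x ++ y)) 0 (x ++ y)
  xy-window = cycle-window (x ++ y)

  yx-window : Window (cycle (x ++ y)) n (y ++ x)
  yx-window = window-++ y x (window-++ʳ x y xy-window)
                            (window-periodic (cycle-periodic (x ++ y)) (window-++ˡ x y xy-window))

odd⇒swapPair-injective : ∀ t (a : Vec Bool (suc (2 ^ t))) → parity a ≡ true →
                         Injective _≡_ _≡_ (swapPair (NBCA (linearRule a)))
odd⇒swapPair-injective t a odd {x , y} {x′ , y′} eq =
  cong₂ _,_ (window-unique g≗g′ (window-++ˡ x y xy-window) (window-++ˡ x′ y′ xy-window′))
            (window-unique g≗g′ (window-++ʳ x y xy-window) (window-++ʳ x′ y′ xy-window′))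
  where
  instance
    period≢0 : NonZero (2 ^ t + 2 ^ t)
    period≢0 = subst NonZero (sym (2^r+2^r≡2^[1+r] t)) (m^n≢0 2 (suc t))

  periodic : (v : Vec Bool (2 ^ t + 2 ^ t)) → Periodic (2 ^ suc t) (cycle v)
  periodic v = subst (λ p → Periodic p (cycle v)) (2^r+2^r≡2^[1+r] t) (cycle-periodic v)

  xy-window : Window (cycle (x ++ y)) 0 (x ++ y)
  xy-window = cycle-window (x ++ y)

  xy-window′ : Window (cycle (x′ ++ y′)) 0 (x′ ++ y′)
  xy-window′ = cycle-window (x′ ++ y′)

  Ag≗Ag′ : convolve 1 a (cycle (x ++ y)) ≗ convolve 1 a (cycle (x′ ++ y′))
  Ag≗Ag′ = periodic-window-unique (periodic-convolve 1 a (cycle-periodic (x ++ y)))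
                                  (periodic-convolve 1 a (cycle-periodic (x′ ++ y′)))
                                  (swapPair-window a x y)
                                  (subst (Window _ 0) (sym (cong (uncurry _++_) eq))
                                         (swapPair-window a x′ y′))

  g≗g′ : cycle (x ++ y) ≗ cycle (x′ ++ y′)
  g≗g′ = odd⇒convolve-injective {r = suc t} a odd (periodic (x ++ y)) (periodic (x′ ++ y′)) Ag≗Ag′

even⇒¬swapPair-injective : ∀ {n} .{{_ : NonZero n}} (a : Vec Bool (suc n)) → parity a ≡ false →
                           ¬ Injective _≡_ _≡_ (swapPair (NBCA (linearRule a)))
even⇒¬swapPair-injective {n} a even inj = true≢false (begin
  true                      ≡⟨ lookup-replicate i true ⟨
  lookup (constant true) i  ≡⟨ cong (λ v → lookup v i) (,-injectiveˡ ones≡zeros) ⟩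
  lookup (constant false) i ≡⟨ lookup-replicate i false ⟩
  false                     ∎)
  where
  constant : Bool → Vec Bool n
  constant = replicate n

  i : Fin n
  i = fromℕ< (>-nonZero⁻¹ n)

  true≢false : true ≢ false
  true≢false ()

  image-of-constant : ∀ b → Window (λ _ → false) 0 (NBCA (linearRule a) (constant b ++ constant b))
  image-of-constant b = window λ f → begin
    lookup (NBCA (linearRule a) (constant b ++ constant b)) f
      ≡⟨ lookup-window (window-NBCA a (window-++ (constant b) (constant b)
                                                  (replicate-window b) (replicate-window b))) f ⟩
    convolve 1 a (λ _ → b) (toℕ f)
      ≡⟨ convolve-period 1 a (λ _ → refl) (toℕ f) ⟩
    parity a ∧ b
      ≡⟨ cong (_∧ b) even ⟩
    false
      ∎

  collide : NBCA (linearRule a) (constant true ++ constant true)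
          ≡ NBCA (linearRule a) (constant false ++ constant false)
  collide = window-unique (λ _ → refl) (image-of-constant true) (image-of-constant false)

  ones≡zeros : (constant true , constant true) ≡ (constant false , constant false)
  ones≡zeros = inj (cong₂ _,_ collide collide)

odd⇔selfOrthogonal : ∀ t (φ : Vec Bool (2 ^ t) ↔ Fin (2 ^ (2 ^ t))) (a : Vec Bool (suc (2 ^ t))) →
                     parity a ≡ true ⇔ SelfOrthogonal φ (NBCA (linearRule a))
odd⇔selfOrthogonal t φ a =
  ⇔-sym (selfOrthogonal⇔swapPair-injective φ (NBCA (linearRule a)))
  ⇔-∘ mk⇔ (odd⇒swapPair-injective t a)
          (λ inj → ¬-not (λ even → even⇒¬swapPair-injective {{m^n≢0 2 t}} a even inj))

ofParity : ∀ m → Bool → List (Vec Bool m)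
ofParity zero    false = [] ∷ []
ofParity zero    true  = []
ofParity (suc m) b     = map (true ∷_) (ofParity m (not b)) List.++ map (false ∷_) (ofParity m b)

∈-ofParity⁺ : ∀ {m} (v : Vec Bool m) → v ∈ ofParity m (parity v)
∈-ofParity⁺ []          = here refl
∈-ofParity⁺ (true ∷ v)  =
  ∈-++⁺ˡ (∈-map⁺ (true ∷_) (subst (λ b → v ∈ ofParity _ b) (sym (not-involutive (parity v)))
                                  (∈-ofParity⁺ v)))
∈-ofParity⁺ (false ∷ v) = ∈-++⁺ʳ _ (∈-map⁺ (false ∷_) (∈-ofParity⁺ v))

∈-ofParity⁻ : ∀ {m b} {v : Vec Bool m} → v ∈ ofParity m b → parity v ≡ b
∈-ofParity⁻ {zero}  {false} (here refl) = refl
∈-ofParity⁻ {suc m} {b} v∈ with ∈-++⁻ (map (true ∷_) (ofParity m (not b))) v∈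
... | inj₁ v∈ᵗ with u , u∈ , refl ← ∈-map⁻ (true ∷_) v∈ᵗ =
  trans (cong not (∈-ofParity⁻ u∈)) (not-involutive b)
... | inj₂ v∈ᶠ with u , u∈ , refl ← ∈-map⁻ (false ∷_) v∈ᶠ = ∈-ofParity⁻ u∈

ofParity-unique : ∀ m b → Unique (ofParity m b)
ofParity-unique zero    false = [] ∷ []
ofParity-unique zero    true  = []
ofParity-unique (suc m) b     =
  ++⁺ (map⁺ ∷-injectiveʳ (ofParity-unique m (not b)))
      (map⁺ ∷-injectiveʳ (ofParity-unique m b))
      disjoint
  where
  disjoint : ∀ {v} → ¬ (v ∈ map (true ∷_) (ofParity m (not b)) × v ∈ map (false ∷_) (ofParity m b))
  disjoint (v∈ᵗ , v∈ᶠ)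
    with _ , _ , refl ← ∈-map⁻ (true ∷_) v∈ᵗ
    with _ , _ , ()   ← ∈-map⁻ (false ∷_) v∈ᶠ

length-ofParity : ∀ m b → length (ofParity (suc m) b) ≡ 2 ^ m
length-ofParity zero    false = refl
length-ofParity zero    true  = refl
length-ofParity (suc m) b     = begin
  length (map (true ∷_) (ofParity (suc m) (not b)) List.++ map (false ∷_) (ofParity (suc m) b))
    ≡⟨ length-++ (map (true ∷_) (ofParity (suc m) (not b))) ⟩
  length (map (true ∷_) (ofParity (suc m) (not b))) + length (map (false ∷_) (ofParity (suc m) b))
    ≡⟨ cong₂ _+_ (length-map (true ∷_) (ofParity (suc m) (not b)))
                 (length-map (false ∷_) (ofParity (suc m) b)) ⟩
  length (ofParity (suc m) (not b)) + length (ofParity (suc m) b)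
    ≡⟨ cong₂ _+_ (length-ofParity m (not b)) (length-ofParity m b) ⟩
  2 ^ m + 2 ^ m
    ≡⟨ 2^r+2^r≡2^[1+r] m ⟩
  2 ^ suc m
    ∎

parity-∷ʳ : ∀ {m} (v : Vec Bool m) c → parity (v ∷ʳ c) ≡ parity v xor c
parity-∷ʳ []      c = xor-identityʳ c
parity-∷ʳ (x ∷ v) c = trans (cong (x xor_) (parity-∷ʳ v c)) (sym (xor-assoc x (parity v) c))

bordered : ∀ {m} → Vec Bool m → Vec Bool (suc (suc m))
bordered v = true ∷ (v ∷ʳ true)

bordered-injective : ∀ {m} {u v : Vec Bool m} → bordered u ≡ bordered v → u ≡ v
bordered-injective {u = u} {v} eq = ∷ʳ-injectiveˡ u v (∷-injectiveʳ eq)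

parity-bordered : ∀ {m} (v : Vec Bool m) → parity (bordered v) ≡ parity v
parity-bordered v =
  trans (cong not (trans (parity-∷ʳ v true) (xor-comm (parity v) true))) (not-involutive (parity v))

borderedOdd : ∀ k → List (Vec Bool (3 + k))
borderedOdd k = map bordered (ofParity (suc k) true)

∈-borderedOdd⁻ : ∀ {k} {a : Vec Bool (3 + k)} → a ∈ borderedOdd k →
                 head a ≡ true × last a ≡ true × parity a ≡ true
∈-borderedOdd⁻ a∈ with v , v∈ , refl ← ∈-map⁻ bordered a∈ =
  refl , last-∷ʳ true v , trans (parity-bordered v) (∈-ofParity⁻ v∈)

∈-borderedOdd⁺ : ∀ {k} (a : Vec Bool (3 + k)) → head a ≡ true × last a ≡ true × parity a ≡ true →
                 a ∈ borderedOdd k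
-- last is defined through initLast, so matching on initLast r turns last≡true into b ≡ true.
∈-borderedOdd⁺ (true ∷ r) (refl , last≡true , odd)
  with v , b , refl ← initLast r
  with refl ← last≡true
  = ∈-map⁺ bordered (subst (λ c → v ∈ ofParity _ c) (trans (sym (parity-bordered v)) odd)
                           (∈-ofParity⁺ v))

borderedOdd-count : ∀ n → 2 ≤ n →
  Σ (List (Vec Bool (suc n))) (λ xs → Unique xs × length xs ≡ 2 ^ (n ∸ 2) ×
    ((a : Vec Bool (suc n)) → a ∈ xs ⇔ (head a ≡ true × last a ≡ true × parity a ≡ true)))
borderedOdd-count (suc zero)    (s≤s ())
borderedOdd-count (suc (suc k)) _ =
  borderedOdd k ,
  map⁺ bordered-injective (ofParity-unique (suc k) true) ,
  trans (length-map bordered (ofParity (suc k) true)) (length-ofParity k true) ,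
  λ a → mk⇔ ∈-borderedOdd⁻ (∈-borderedOdd⁺ a)

lemma5 : (t : ℕ) → 1 ≤ t → (φ : Vec Bool (2 ^ t) ↔ Fin (2 ^ (2 ^ t))) →
    Σ (List (Vec Bool (suc (2 ^ t)))) (λ xs →
      Unique xs × length xs ≡ 2 ^ (2 ^ t ∸ 2) ×
      ((a : Vec Bool (suc (2 ^ t))) →
        (a ∈ xs ⇔ (head a ≡ true × last a ≡ true × SelfOrthogonal φ (NBCA (linearRule a))))))
lemma5 t 1≤t φ =
  let xs , unique , length≡ , ∈xs⇔ = borderedOdd-count (2 ^ t) (^-monoʳ-≤ 2 1≤t)
  in xs , unique , length≡ ,
     λ a → (⇔-id _ ×-⇔ ⇔-id _ ×-⇔ odd⇔selfOrthogonal t φ a) ⇔-∘ ∈xs⇔ a
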